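{- For every type $A$, $[[[A]]]\le^a[3,A]$.
   Context: Simply typed $\lambda$-calculus over base type $0$; every type is uniquely $[B_1,\dots,B_m]:=B_1\to\cdots\to B_m\to0$; $1:=[0]$, $2:=[1]$, $3:=[2]$. A context $\Gamma=x_1^{C_1},\dots,x_k^{C_k}$ is a finite list of distinct typed variables, $\{\Gamma\}$ its set, $[\Gamma]:=[C_1,\dots,C_k]$; terms identified up to $\beta\eta$ ($=_{\beta\eta}$); $\Lambda^\Xi(A)$ = terms of type $A$ with free variables in $\{\Xi\}$. A substitution $\varrho$ from $\Gamma$ to $\Delta$ assigns $\varrho_c\in\Lambda^\Delta(C)$ to each $c^C\in\{\Gamma\}$; for a fresh context $\Xi$, $\varrho^\Xi$ is $\varrho$ on $\{\Gamma\}$ and the identity on $\{\Xi\}$. $\varrho$ is an atomic reduction if for every fresh $\Xi$, all $a^A,b^B\in\{\Xi,\Gamma\}$ with $A\equiv[A_1,\dots,A_n]$, $B\equiv[B_1,\dots,B_m]$, and all $M_i\in\Lambda^{\Xi,\Delta}(A_i)$, $N_i\in\Lambda^{\Xi,\Delta}(B_i)$: $\varrho^\Xi_aM_1\cdots M_n=_{\beta\eta}\varrho^\Xi_bN_1\cdots N_m$ implies $a=b$ and all $M_i=N_i$. For types, $[\Gamma]\le^a[\Delta]$ means there is an atomic reduction from the context $\Gamma$ to the context $\Delta$. -}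

module Defs where

open import Data.List using (List; []; _∷_; _++_; foldr)
open import Data.List.Relation.Unary.All using (All; []; _∷_)
open import Data.Product using (Σ)

-- Simple types over the base type 0 (written ι)

infixr 7 _⇒_
data Ty : Set where
  ι   : Ty
  _⇒_ : Ty → Ty → Ty

-- [B₁,…,Bₘ] := B₁ → ⋯ → Bₘ → 0
⟦_⟧ : List Ty → Ty
⟦ Bs ⟧ = foldr _⇒_ ι Bs

-- the unique argument list of a type: A ≡ ⟦ args A ⟧
args : Ty → List Ty
args ι       = []
args (A ⇒ B) = A ∷ args B

one two three : Ty
one   = ⟦ ι ∷ [] ⟧
two   = ⟦ one ∷ [] ⟧
three = ⟦ two ∷ [] ⟧

Ctx : Set
Ctx = List Ty

data Var : Ctx → Ty → Set where
  ze : ∀ {Γ A} → Var (A ∷ Γ) A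
  su : ∀ {Γ A B} → Var Γ A → Var (B ∷ Γ) A

data Tm (Γ : Ctx) : Ty → Set where
  var : ∀ {A} → Var Γ A → Tm Γ A
  lam : ∀ {A B} → Tm (A ∷ Γ) B → Tm Γ (A ⇒ B)
  app : ∀ {A B} → Tm Γ (A ⇒ B) → Tm Γ A → Tm Γ B

Ren : Ctx → Ctx → Set
Ren Γ Δ = ∀ {A} → Var Γ A → Var Δ A

liftR : ∀ {Γ Δ B} → Ren Γ Δ → Ren (B ∷ Γ) (B ∷ Δ)
liftR r ze     = ze
liftR r (su v) = su (r v)

rename : ∀ {Γ Δ A} → Ren Γ Δ → Tm Γ A → Tm Δ A
rename r (var v)   = var (r v)
rename r (lam t)   = lam (rename (liftR r) t)
rename r (app t u) = app (rename r t) (rename r u)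

weaken : ∀ {Γ A B} → Tm Γ A → Tm (B ∷ Γ) A
weaken = rename su

Subst : Ctx → Ctx → Set
Subst Γ Δ = ∀ {C} → Var Γ C → Tm Δ C

liftS : ∀ {Γ Δ B} → Subst Γ Δ → Subst (B ∷ Γ) (B ∷ Δ)
liftS s ze     = var ze
liftS s (su v) = weaken (s v)

subst : ∀ {Γ Δ A} → Subst Γ Δ → Tm Γ A → Tm Δ A
subst s (var v)   = s v
subst s (lam t)   = lam (subst (liftS s) t)
subst s (app t u) = app (subst s t) (subst s u)

single : ∀ {Γ A} → Tm Γ A → Subst (A ∷ Γ) Γ
single u ze     = u
single u (su v) = var v

infix 4 _≈_
data _≈_ : ∀ {Γ A} → Tm Γ A → Tm Γ A → Set where
  β      : ∀ {Γ A B} (t : Tm (A ∷ Γ) B) (u : Tm Γ A) →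
           app (lam t) u ≈ subst (single u) t
  η      : ∀ {Γ A B} (t : Tm Γ (A ⇒ B)) →
           t ≈ lam (app (weaken t) (var ze))
  ≈refl  : ∀ {Γ A} {t : Tm Γ A} → t ≈ t
  ≈sym   : ∀ {Γ A} {t u : Tm Γ A} → t ≈ u → u ≈ t
  ≈trans : ∀ {Γ A} {t u v : Tm Γ A} → t ≈ u → u ≈ v → t ≈ v
  ≈lam   : ∀ {Γ A B} {t u : Tm (A ∷ Γ) B} → t ≈ u → lam t ≈ lam u
  ≈app   : ∀ {Γ A B} {t t' : Tm Γ (A ⇒ B)} {u u' : Tm Γ A} →
           t ≈ t' → u ≈ u' → app t u ≈ app t' u'

Args : Ctx → Ty → Set
Args Θ A = All (Tm Θ) (args A)

apps : ∀ {Θ} A → Tm Θ A → Args Θ A → Tm Θ ι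
apps ι       t []       = t
apps (A ⇒ B) t (m ∷ ms) = apps B (app t m) ms

data PwEq {Θ : Ctx} : (As : List Ty) → All (Tm Θ) As → All (Tm Θ) As → Set where
  []  : PwEq [] [] []
  _∷_ : ∀ {A As m n ms ns} → m ≈ n → PwEq As ms ns → PwEq (A ∷ As) (m ∷ ms) (n ∷ ns)

data SameApp {Θ Φ : Ctx} : ∀ {A B} → Var Θ A → Args Φ A → Var Θ B → Args Φ B → Set where
  same : ∀ {A} {a : Var Θ A} {ms ns : Args Φ A} →
         PwEq (args A) ms ns → SameApp a ms a ns

extΞ : ∀ {Γ Δ} (Ξ : Ctx) → Subst Γ Δ → Subst (Ξ ++ Γ) (Ξ ++ Δ)
extΞ []      ρ v      = ρ v
extΞ (X ∷ Ξ) ρ ze     = var ze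
extΞ (X ∷ Ξ) ρ (su v) = weaken (extΞ Ξ ρ v)

AtomicReduction : ∀ {Γ Δ} → Subst Γ Δ → Set
AtomicReduction {Γ} {Δ} ρ =
  ∀ (Ξ : Ctx) {A B} (a : Var (Ξ ++ Γ) A) (b : Var (Ξ ++ Γ) B)
    (ms : Args (Ξ ++ Δ) A) (ns : Args (Ξ ++ Δ) B) →
    apps A (extΞ Ξ ρ a) ms ≈ apps B (extΞ Ξ ρ b) ns →
    SameApp a ms b ns

-- [Γ] ≤ᵃ [Δ]: an atomic reduction from the context Γ to the context Δ,
-- where Γ, Δ are the (unique) argument lists of the two types
infix 4 _≤ᵃ_
_≤ᵃ_ : Ty → Ty → Set
T ≤ᵃ U = Σ (Subst (args T) (args U)) AtomicReduction

-- The substitution sends x : [[[A]]] to λN. f (λg. N (g ∘ z)), where f : 3 and z : A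
-- are the variables of [3, A] and g ∘ z is η-long.  Normal forms headed by a variable
-- determine head and arguments, so atomicity comes down to injectivity of
-- N ↦ λg. N (g ∘ z) up to βη.  There the fresh variable g marks exactly the occurrences
-- of g ∘ z that stem from the argument of N, so substituting g ∘ z for a variable is
-- injective on normal forms; βη-equality is decided by normalisation by evaluation.
module Submission where

open import Data.Bool using (Bool; true; false)
open import Data.Empty using (⊥; ⊥-elim)
open import Data.List using (List; []; _∷_; _++_)
open import Data.List.Relation.Unary.All as All using (All; []; _∷_)
open import Data.Product using (Σ; _,_; proj₁; proj₂; _×_)
open import Function using (_∘_)
open import Relation.Binary.Bundles using (Setoid)
import Relation.Binary.Reasoning.Setoid as SetoidReasoning
open import Relation.Binary.PropositionalEquality
  using (_≡_; refl; sym; trans; cong; cong₂; module ≡-Reasoning)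

open import Defs

private variable
  Γ Δ Θ Ψ : Ctx
  A B C D : Ty

≡⇒≈ : {t u : Tm Γ A} → t ≡ u → t ≈ u
≡⇒≈ refl = ≈refl

≈-setoid : Ctx → Ty → Setoid _ _
≈-setoid Γ A = record
  { Carrier       = Tm Γ A
  ; _≈_           = _≈_
  ; isEquivalence = record { refl = ≈refl ; sym = ≈sym ; trans = ≈trans }
  }

module ≈-Reasoning {Γ : Ctx} {A : Ty} = SetoidReasoning (≈-setoid Γ A)

liftR-cong : {r r' : Ren Γ Δ} → (∀ {C} (v : Var Γ C) → r v ≡ r' v) →
             ∀ {C} (v : Var (B ∷ Γ) C) → liftR r v ≡ liftR r' v
liftR-cong e ze     = refl
liftR-cong e (su v) = cong su (e v)

liftR-id : ∀ {C} (v : Var (B ∷ Γ) C) → liftR (λ x → x) v ≡ v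
liftR-id ze     = refl
liftR-id (su v) = refl

liftR-∘ : (r : Ren Δ Θ) (r' : Ren Γ Δ) →
          ∀ {C} (v : Var (B ∷ Γ) C) → liftR r (liftR r' v) ≡ liftR (λ x → r (r' x)) v
liftR-∘ r r' ze     = refl
liftR-∘ r r' (su v) = refl

rename-cong : {r r' : Ren Γ Δ} → (∀ {C} (v : Var Γ C) → r v ≡ r' v) →
              (t : Tm Γ A) → rename r t ≡ rename r' t
rename-cong e (var v)   = cong var (e v)
rename-cong e (lam t)   = cong lam (rename-cong (liftR-cong e) t)
rename-cong e (app t u) = cong₂ app (rename-cong e t) (rename-cong e u)

rename-id : (t : Tm Γ A) → rename (λ v → v) t ≡ t
rename-id (var v)   = refl
rename-id (lam t)   = cong lam (trans (rename-cong liftR-id t) (rename-id t))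
rename-id (app t u) = cong₂ app (rename-id t) (rename-id u)

rename-∘ : (r : Ren Δ Θ) (r' : Ren Γ Δ) (t : Tm Γ A) →
           rename r (rename r' t) ≡ rename (λ v → r (r' v)) t
rename-∘ r r' (var v)   = refl
rename-∘ r r' (lam t)   =
  cong lam (trans (rename-∘ (liftR r) (liftR r') t) (rename-cong (liftR-∘ r r') t))
rename-∘ r r' (app t u) = cong₂ app (rename-∘ r r' t) (rename-∘ r r' u)

rename-liftR-weaken : (r : Ren Γ Δ) (t : Tm Γ A) →
                      rename (liftR {B = B} r) (weaken t) ≡ weaken (rename r t)
rename-liftR-weaken r t = trans (rename-∘ (liftR r) su t) (sym (rename-∘ su r t))

liftS-cong : {s s' : Subst Γ Δ} → (∀ {C} (v : Var Γ C) → s v ≡ s' v) →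
             ∀ {C} (v : Var (B ∷ Γ) C) → liftS s v ≡ liftS s' v
liftS-cong e ze     = refl
liftS-cong e (su v) = cong weaken (e v)

subst-cong : {s s' : Subst Γ Δ} → (∀ {C} (v : Var Γ C) → s v ≡ s' v) →
             (t : Tm Γ A) → subst s t ≡ subst s' t
subst-cong e (var v)   = e v
subst-cong e (lam t)   = cong lam (subst-cong (liftS-cong e) t)
subst-cong e (app t u) = cong₂ app (subst-cong e t) (subst-cong e u)

subst-var≡rename : (r : Ren Γ Δ) (t : Tm Γ A) → subst (λ v → var (r v)) t ≡ rename r t
subst-var≡rename r (var v)   = refl
subst-var≡rename r (lam t)   =
  cong lam (trans (subst-cong (λ { ze → refl ; (su v) → refl }) t) (subst-var≡rename (liftR r) t))
subst-var≡rename r (app t u) = cong₂ app (subst-var≡rename r t) (subst-var≡rename r u)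

subst-var : (t : Tm Γ A) → subst var t ≡ t
subst-var t = trans (subst-var≡rename (λ v → v) t) (rename-id t)

subst-rename : (s : Subst Δ Θ) (r : Ren Γ Δ) (t : Tm Γ A) →
               subst s (rename r t) ≡ subst (λ v → s (r v)) t
subst-rename s r (var v)   = refl
subst-rename s r (lam t)   =
  cong lam (trans (subst-rename (liftS s) (liftR r) t) (subst-cong (λ { ze → refl ; (su v) → refl }) t))
subst-rename s r (app t u) = cong₂ app (subst-rename s r t) (subst-rename s r u)

rename-subst : (r : Ren Δ Θ) (s : Subst Γ Δ) (t : Tm Γ A) →
               rename r (subst s t) ≡ subst (λ v → rename r (s v)) t
rename-subst r s (var v)   = refl
rename-subst r s (lam t)   = cong lam (trans (rename-subst (liftR r) (liftS s) t) (subst-cong lift t))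
  where
  lift : ∀ {C} (v : Var _ C) → rename (liftR r) (liftS s v) ≡ liftS (λ x → rename r (s x)) v
  lift ze     = refl
  lift (su v) = rename-liftR-weaken r (s v)
rename-subst r s (app t u) = cong₂ app (rename-subst r s t) (rename-subst r s u)

subst-liftS-weaken : (s : Subst Γ Δ) (t : Tm Γ A) →
                     subst (liftS {B = B} s) (weaken t) ≡ weaken (subst s t)
subst-liftS-weaken s t = trans (subst-rename (liftS s) su t) (sym (rename-subst su s t))

subst-∘ : (s : Subst Δ Θ) (s' : Subst Γ Δ) (t : Tm Γ A) →
          subst s (subst s' t) ≡ subst (λ v → subst s (s' v)) t
subst-∘ s s' (var v)   = refl
subst-∘ s s' (lam t)   = cong lam (trans (subst-∘ (liftS s) (liftS s') t) (subst-cong lift t))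
  where
  lift : ∀ {C} (v : Var _ C) → subst (liftS s) (liftS s' v) ≡ liftS (λ x → subst s (s' x)) v
  lift ze     = refl
  lift (su v) = subst-liftS-weaken s (s' v)
subst-∘ s s' (app t u) = cong₂ app (subst-∘ s s' t) (subst-∘ s s' u)

subst-single-weaken : (u : Tm Γ B) (t : Tm Γ A) → subst (single u) (weaken t) ≡ t
subst-single-weaken u t = trans (subst-rename (single u) su t) (subst-var t)

rename-≈ : (r : Ren Γ Δ) {t u : Tm Γ A} → t ≈ u → rename r t ≈ rename r u
rename-≈ r (β t u)      = ≈trans (β _ _) (≡⇒≈ (begin
  subst (single (rename r u)) (rename (liftR r) t)  ≡⟨ subst-rename _ (liftR r) t ⟩
  subst _ t                                          ≡⟨ subst-cong (λ { ze → refl ; (su v) → refl }) t ⟩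
  subst (λ v → rename r (single u v)) t              ≡⟨ rename-subst r (single u) t ⟨
  rename r (subst (single u) t)                      ∎))
  where open ≡-Reasoning
rename-≈ r (η t)        =
  ≈trans (η _) (≡⇒≈ (cong (λ x → lam (app x (var ze))) (sym (rename-liftR-weaken r t))))
rename-≈ r ≈refl        = ≈refl
rename-≈ r (≈sym p)     = ≈sym (rename-≈ r p)
rename-≈ r (≈trans p q) = ≈trans (rename-≈ r p) (rename-≈ r q)
rename-≈ r (≈lam p)     = ≈lam (rename-≈ (liftR r) p)
rename-≈ r (≈app p q)   = ≈app (rename-≈ r p) (rename-≈ r q)

subst-≈ : (s : Subst Γ Δ) {t u : Tm Γ A} → t ≈ u → subst s t ≈ subst s u
subst-≈ s (β t u)      = ≈trans (β _ _) (≡⇒≈ (begin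
  subst (single (subst s u)) (subst (liftS s) t)  ≡⟨ subst-∘ _ (liftS s) t ⟩
  subst _ t                                        ≡⟨ subst-cong commute t ⟩
  subst (λ v → subst s (single u v)) t             ≡⟨ subst-∘ s (single u) t ⟨
  subst s (subst (single u) t)                     ∎))
  where
  open ≡-Reasoning
  commute : ∀ {C} (v : Var _ C) → subst (single (subst s u)) (liftS s v) ≡ subst s (single u v)
  commute ze     = refl
  commute (su v) = subst-single-weaken _ (s v)
subst-≈ s (η t)        =
  ≈trans (η _) (≡⇒≈ (cong (λ x → lam (app x (var ze))) (sym (subst-liftS-weaken s t))))
subst-≈ s ≈refl        = ≈refl
subst-≈ s (≈sym p)     = ≈sym (subst-≈ s p)
subst-≈ s (≈trans p q) = ≈trans (subst-≈ s p) (subst-≈ s q)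
subst-≈ s (≈lam p)     = ≈lam (subst-≈ (liftS s) p)
subst-≈ s (≈app p q)   = ≈app (subst-≈ s p) (subst-≈ s q)

lam-injective : {P Q : Tm (A ∷ Γ) B} → lam P ≈ lam Q → P ≈ Q
lam-injective {P = P} {Q} h = begin
  P                              ≈⟨ app-weaken-lam P ⟨
  app (weaken (lam P)) (var ze)  ≈⟨ ≈app (rename-≈ su h) ≈refl ⟩
  app (weaken (lam Q)) (var ze)  ≈⟨ app-weaken-lam Q ⟩
  Q                              ∎
  where
  open ≈-Reasoning
  app-weaken-lam : (P : Tm (A ∷ Γ) B) → app (weaken (lam P)) (var ze) ≈ P
  app-weaken-lam P = ≈trans (β _ _) (≡⇒≈ (trans (subst-rename _ (liftR su) P)
    (trans (subst-cong (λ { ze → refl ; (su v) → refl }) P) (subst-var P))))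

mutual
  data Ne (Γ : Ctx) : Ty → Set where
    varN : Var Γ A → Ne Γ A
    appN : Ne Γ (A ⇒ B) → Nf Γ A → Ne Γ B

  data Nf (Γ : Ctx) : Ty → Set where
    neN  : Ne Γ ι → Nf Γ ι
    lamN : Nf (A ∷ Γ) B → Nf Γ (A ⇒ B)

mutual
  embNe : Ne Γ A → Tm Γ A
  embNe (varN v)   = var v
  embNe (appN n p) = app (embNe n) (embNf p)

  embNf : Nf Γ A → Tm Γ A
  embNf (neN n)  = embNe n
  embNf (lamN p) = lam (embNf p)

mutual
  renNe : Ren Γ Δ → Ne Γ A → Ne Δ A
  renNe r (varN v)   = varN (r v)
  renNe r (appN n p) = appN (renNe r n) (renNf r p)

  renNf : Ren Γ Δ → Nf Γ A → Nf Δ A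
  renNf r (neN n)  = neN (renNe r n)
  renNf r (lamN p) = lamN (renNf (liftR r) p)

mutual
  renNe-cong : {r r' : Ren Γ Δ} → (∀ {C} (v : Var Γ C) → r v ≡ r' v) →
               (n : Ne Γ A) → renNe r n ≡ renNe r' n
  renNe-cong e (varN v)   = cong varN (e v)
  renNe-cong e (appN n p) = cong₂ appN (renNe-cong e n) (renNf-cong e p)

  renNf-cong : {r r' : Ren Γ Δ} → (∀ {C} (v : Var Γ C) → r v ≡ r' v) →
               (p : Nf Γ A) → renNf r p ≡ renNf r' p
  renNf-cong e (neN n)  = cong neN (renNe-cong e n)
  renNf-cong e (lamN p) = cong lamN (renNf-cong (liftR-cong e) p)

mutual
  renNe-id : (n : Ne Γ A) → renNe (λ v → v) n ≡ n
  renNe-id (varN v)   = refl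
  renNe-id (appN n p) = cong₂ appN (renNe-id n) (renNf-id p)

  renNf-id : (p : Nf Γ A) → renNf (λ v → v) p ≡ p
  renNf-id (neN n)  = cong neN (renNe-id n)
  renNf-id (lamN p) = cong lamN (trans (renNf-cong liftR-id p) (renNf-id p))

mutual
  renNe-∘ : (r : Ren Δ Θ) (r' : Ren Γ Δ) (n : Ne Γ A) →
            renNe r (renNe r' n) ≡ renNe (λ v → r (r' v)) n
  renNe-∘ r r' (varN v)   = refl
  renNe-∘ r r' (appN n p) = cong₂ appN (renNe-∘ r r' n) (renNf-∘ r r' p)

  renNf-∘ : (r : Ren Δ Θ) (r' : Ren Γ Δ) (p : Nf Γ A) →
            renNf r (renNf r' p) ≡ renNf (λ v → r (r' v)) p
  renNf-∘ r r' (neN n)  = cong neN (renNe-∘ r r' n)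
  renNf-∘ r r' (lamN p) =
    cong lamN (trans (renNf-∘ (liftR r) (liftR r') p) (renNf-cong (liftR-∘ r r') p))

mutual
  rename-embNe : (r : Ren Γ Δ) (n : Ne Γ A) → rename r (embNe n) ≡ embNe (renNe r n)
  rename-embNe r (varN v)   = refl
  rename-embNe r (appN n p) = cong₂ app (rename-embNe r n) (rename-embNf r p)

  rename-embNf : (r : Ren Γ Δ) (p : Nf Γ A) → rename r (embNf p) ≡ embNf (renNf r p)
  rename-embNf r (neN n)  = rename-embNe r n
  rename-embNf r (lamN p) = cong lam (rename-embNf (liftR r) p)

Val : Ctx → Ty → Set
Val Γ ι       = Ne Γ ι
Val Γ (A ⇒ B) = ∀ {Δ} → Ren Γ Δ → Val Δ A → Val Δ B

renV : ∀ A → Ren Γ Δ → Val Γ A → Val Δ A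
renV ι       r n = renNe r n
renV (A ⇒ B) r f = λ r' v → f (λ x → r' (r x)) v

mutual
  reflect : ∀ A → Ne Γ A → Val Γ A
  reflect ι       n = n
  reflect (A ⇒ B) n = λ r v → reflect B (appN (renNe r n) (reify A v))

  reify : ∀ A → Val Γ A → Nf Γ A
  reify ι       n = neN n
  reify (A ⇒ B) f = lamN (reify B (f su (reflect A (varN ze))))

Env : Ctx → Ctx → Set
Env Γ Δ = ∀ {A} → Var Γ A → Val Δ A

extE : Env Γ Δ → Val Δ A → Env (A ∷ Γ) Δ
extE ρ v ze     = v
extE ρ v (su x) = ρ x

renE : Ren Δ Θ → Env Γ Δ → Env Γ Θ
renE r ρ {A} x = renV A r (ρ x)

eval : Tm Γ A → Env Γ Δ → Val Δ A
eval (var v)   ρ = ρ v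
eval (lam t)   ρ = λ r v → eval t (extE (renE r ρ) v)
eval (app t u) ρ = eval t ρ (λ v → v) (eval u ρ)

idE : Env Γ Γ
idE {A = A} v = reflect A (varN v)

nf : Tm Γ A → Nf Γ A
nf {A = A} t = reify A (eval t idE)

-- Function values are arbitrary Kripke functions; Eq only relates those that commute
-- with renaming, which is what makes reification respect βη.
mutual
  Eq : ∀ A → Val Γ A → Val Γ A → Set
  Eq ι       n m = n ≡ m
  Eq (A ⇒ B) f g =
    (∀ {Δ} (r : Ren _ Δ) {v w} → Eq A v w → Eq B (f r v) (g r w)) × Uniform A B f × Uniform A B g

  Uniform : ∀ A B → Val Γ (A ⇒ B) → Set
  Uniform {Γ} A B f = ∀ {Δ Θ} (r : Ren Γ Δ) (r' : Ren Δ Θ) {v} → Eq A v v →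
    Eq B (renV B r' (f r v)) (f (λ x → r' (r x)) (renV A r' v))

Eq-sym : ∀ A {v w : Val Γ A} → Eq A v w → Eq A w v
Eq-sym ι       p           = sym p
Eq-sym (A ⇒ B) (p , u , u') = (λ r q → Eq-sym B (p r (Eq-sym A q))) , u' , u

Eq-trans : ∀ A {v w x : Val Γ A} → Eq A v w → Eq A w x → Eq A v x
Eq-trans ι       p           q            = trans p q
Eq-trans (A ⇒ B) (p , u , _) (q , _ , u') =
  (λ r e → Eq-trans B (p r e) (q r (Eq-trans A (Eq-sym A e) e))) , u , u'

Eq-reflˡ : ∀ A {v w : Val Γ A} → Eq A v w → Eq A v v
Eq-reflˡ A p = Eq-trans A p (Eq-sym A p)

Eq-reflʳ : ∀ A {v w : Val Γ A} → Eq A v w → Eq A w w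
Eq-reflʳ A p = Eq-trans A (Eq-sym A p) p

renV-Eq : ∀ A (r : Ren Γ Δ) {v w} → Eq A v w → Eq A (renV A r v) (renV A r w)
renV-Eq ι       r p           = cong (renNe r) p
renV-Eq (A ⇒ B) r (p , u , u') = (λ r' → p _) , (λ _ → u _) , (λ _ → u' _)

renV-id : ∀ A {v : Val Γ A} → Eq A v v → Eq A (renV A (λ x → x) v) v
renV-id ι       {v} p = renNe-id v
renV-id (A ⇒ B)     p = p

renV-∘ : ∀ A (r : Ren Δ Θ) (r' : Ren Γ Δ) {v : Val Γ A} → Eq A v v →
         Eq A (renV A r (renV A r' v)) (renV A (λ x → r (r' x)) v)
renV-∘ ι       r r' {v} p = renNe-∘ r r' v
renV-∘ (A ⇒ B) r r'     p = renV-Eq (A ⇒ B) (λ x → r (r' x)) p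

mutual
  reify-Eq : ∀ A {v w : Val Γ A} → Eq A v w → reify A v ≡ reify A w
  reify-Eq ι       p           = cong neN p
  reify-Eq (A ⇒ B) (p , _ , _) = cong lamN (reify-Eq B (p su (reflect-Eq A (varN ze))))

  reflect-Eq : ∀ A (n : Ne Γ A) → Eq A (reflect A n) (reflect A n)
  reflect-Eq ι       n = refl
  reflect-Eq (A ⇒ B) n = pointwise , uniform , uniform
    where
    pointwise : ∀ {Δ} (r : Ren _ Δ) {v w} → Eq A v w →
                Eq B (reflect B (appN (renNe r n) (reify A v))) (reflect B (appN (renNe r n) (reify A w)))
    pointwise r q rewrite reify-Eq A q = reflect-Eq B _

    uniform : Uniform A B (reflect (A ⇒ B) n)
    uniform r r' {v} q rewrite sym (renNe-∘ r' r n) | sym (renNf-reify A r' q) =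
      renV-reflect B r' _

  renV-reflect : ∀ A (r : Ren Γ Δ) (n : Ne Γ A) → Eq A (renV A r (reflect A n)) (reflect A (renNe r n))
  renV-reflect ι       r n = refl
  renV-reflect (A ⇒ B) r n =
    pointwise
    , proj₁ (proj₂ (renV-Eq (A ⇒ B) r (reflect-Eq (A ⇒ B) n)))
    , proj₁ (proj₂ (reflect-Eq (A ⇒ B) (renNe r n)))
    where
    pointwise : ∀ {Δ'} (r' : Ren _ Δ') {v w} → Eq A v w →
                Eq B (reflect B (appN (renNe (λ x → r' (r x)) n) (reify A v)))
                     (reflect B (appN (renNe r' (renNe r n)) (reify A w)))
    pointwise r' q rewrite renNe-∘ r' r n | reify-Eq A q = reflect-Eq B _

  renNf-reify : ∀ A (r : Ren Γ Δ) {v : Val Γ A} → Eq A v v → renNf r (reify A v) ≡ reify A (renV A r v)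
  renNf-reify ι       r p           = refl
  renNf-reify (A ⇒ B) r (p , u , _) = cong lamN (trans
    (renNf-reify B (liftR r) (p su (reflect-Eq A (varN ze))))
    (reify-Eq B (Eq-trans B (u su (liftR r) (reflect-Eq A (varN ze)))
                            (p (λ x → su (r x)) (renV-reflect A (liftR r) (varN ze))))))

EqEnv : Env Γ Δ → Env Γ Δ → Set
EqEnv {Γ} ρ ρ' = ∀ {A} (x : Var Γ A) → Eq A (ρ x) (ρ' x)

EqEnv-sym : {ρ ρ' : Env Γ Δ} → EqEnv ρ ρ' → EqEnv ρ' ρ
EqEnv-sym e x = Eq-sym _ (e x)

EqEnv-reflˡ : {ρ ρ' : Env Γ Δ} → EqEnv ρ ρ' → EqEnv ρ ρ
EqEnv-reflˡ e x = Eq-reflˡ _ (e x)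

EqEnv-reflʳ : {ρ ρ' : Env Γ Δ} → EqEnv ρ ρ' → EqEnv ρ' ρ'
EqEnv-reflʳ e x = Eq-reflʳ _ (e x)

extE-Eq : {ρ ρ' : Env Γ Δ} → EqEnv ρ ρ' → {v w : Val Δ A} → Eq A v w → EqEnv (extE ρ v) (extE ρ' w)
extE-Eq e q ze     = q
extE-Eq e q (su x) = e x

renE-Eq : (r : Ren Δ Θ) {ρ ρ' : Env Γ Δ} → EqEnv ρ ρ' → EqEnv (renE r ρ) (renE r ρ')
renE-Eq r e x = renV-Eq _ r (e x)

idE-Eq : EqEnv (idE {Γ}) idE
idE-Eq x = reflect-Eq _ (varN x)

mutual
  eval-Eq : (t : Tm Γ A) {ρ ρ' : Env Γ Δ} → EqEnv ρ ρ' → Eq A (eval t ρ) (eval t ρ')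
  eval-Eq (var x)   e = e x
  eval-Eq (app t u) e = proj₁ (eval-Eq t e) (λ v → v) (eval-Eq u e)
  eval-Eq (lam t)   e =
    (λ r q → eval-Eq t (extE-Eq (renE-Eq r e) q))
    , eval-lam-uniform t (EqEnv-reflˡ e) , eval-lam-uniform t (EqEnv-reflʳ e)

  eval-lam-uniform : (t : Tm (A ∷ Γ) B) {ρ : Env Γ Δ} → EqEnv ρ ρ → Uniform A B (eval (lam t) ρ)
  eval-lam-uniform {A = A} t {ρ} e r r' {v} q = Eq-trans _ (renV-eval t r' (extE-Eq (renE-Eq r e) q)) (eval-Eq t env)
    where
    env : EqEnv (renE r' (extE (renE r ρ) v)) (extE (renE (λ x → r' (r x)) ρ) (renV A r' v))
    env ze     = renV-Eq A r' q
    env (su x) = renV-∘ _ r' r (e x)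

  renV-eval : (t : Tm Γ A) (r : Ren Δ Θ) {ρ : Env Γ Δ} → EqEnv ρ ρ →
              Eq A (renV A r (eval t ρ)) (eval t (renE r ρ))
  renV-eval (var x)   r e = renV-Eq _ r (e x)
  renV-eval (app t u) r e = Eq-trans _ (proj₁ (proj₂ (eval-Eq t e)) (λ v → v) r (eval-Eq u e))
                                       (proj₁ (renV-eval t r e) (λ v → v) (renV-eval u r e))
  renV-eval {A = A ⇒ B} (lam t) r {ρ} e =
    (λ r' q → eval-Eq t (env r' q)) , (λ _ → eval-lam-uniform t e _) , eval-lam-uniform t (renE-Eq r e)
    where
    env : ∀ {Θ'} (r' : Ren _ Θ') {v w} → Eq A v w →
          EqEnv (extE (renE (λ x → r' (r x)) ρ) v) (extE (renE r' (renE r ρ)) w)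
    env r' q ze     = q
    env r' q (su x) = Eq-sym _ (renV-∘ _ r' r (e x))

eval-rename : (t : Tm Γ A) (r : Ren Γ Δ) {ρ ρ' : Env Δ Θ} → EqEnv ρ ρ' →
              Eq A (eval (rename r t) ρ) (eval t (λ x → ρ' (r x)))
eval-rename (var x)   r e = e (r x)
eval-rename (app t u) r e = proj₁ (eval-rename t r e) (λ v → v) (eval-rename u r e)
eval-rename {A = A ⇒ B} (lam t) r {ρ} {ρ'} e =
  (λ r' q → Eq-trans B (eval-rename t (liftR r) (extE-Eq (renE-Eq r' e) q)) (eval-Eq t (env r' q)))
  , eval-lam-uniform (rename (liftR r) t) (EqEnv-reflˡ e) , eval-lam-uniform t (λ x → EqEnv-reflʳ e (r x))
  where
  env : ∀ {Θ'} (r' : Ren _ Θ') {v w} → Eq A v w →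
        EqEnv (λ x → extE (renE r' ρ') w (liftR r x)) (extE (renE r' (λ x → ρ' (r x))) w)
  env r' q ze     = Eq-reflʳ A q
  env r' q (su x) = renV-Eq _ r' (EqEnv-reflʳ e (r x))

eval-subst : (t : Tm Γ A) (s : Subst Γ Δ) {ρ ρ' : Env Δ Θ} → EqEnv ρ ρ' →
             Eq A (eval (subst s t) ρ) (eval t (λ x → eval (s x) ρ'))
eval-subst (var x)   s e = eval-Eq (s x) e
eval-subst (app t u) s e = proj₁ (eval-subst t s e) (λ v → v) (eval-subst u s e)
eval-subst {A = A ⇒ B} (lam t) s {ρ} {ρ'} e =
  (λ r q → Eq-trans B (eval-subst t (liftS s) (extE-Eq (renE-Eq r e) q)) (eval-Eq t (env r q)))
  , eval-lam-uniform (subst (liftS s) t) (EqEnv-reflˡ e) , eval-lam-uniform t (λ x → eval-Eq (s x) (EqEnv-reflʳ e))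
  where
  env : ∀ {Θ'} (r : Ren _ Θ') {v w} → Eq A v w →
        EqEnv (λ x → eval (liftS s x) (extE (renE r ρ') w)) (extE (renE r (λ x → eval (s x) ρ')) w)
  env r q ze     = Eq-reflʳ A q
  env r q (su x) = Eq-trans _ (eval-rename (s x) su (extE-Eq (renE-Eq r (EqEnv-reflʳ e)) (Eq-reflʳ A q)))
                              (Eq-sym _ (renV-eval (s x) r (EqEnv-reflʳ e)))

eval-≈ : {t u : Tm Γ A} → t ≈ u → {ρ ρ' : Env Γ Δ} → EqEnv ρ ρ' → Eq A (eval t ρ) (eval u ρ')
eval-≈ (β t u) {ρ} e = Eq-trans _ (eval-Eq t env) (Eq-sym _ (eval-subst t (single u) (EqEnv-sym e)))
  where
  env : EqEnv (extE (renE (λ x → x) ρ) (eval u ρ)) (λ x → eval (single u x) ρ)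
  env ze     = eval-Eq u (EqEnv-reflˡ e)
  env (su x) = renV-id _ (EqEnv-reflˡ e x)
eval-≈ {A = A ⇒ B} (η t) e =
  (λ r q → Eq-trans B (proj₁ (eval-Eq t e) r q)
     (Eq-trans B (proj₁ (renV-eval t r e') (λ x → x) (Eq-reflʳ A q))
       (proj₁ (Eq-sym _ (eval-rename t su (extE-Eq (renE-Eq r e') (Eq-reflʳ A q)))) (λ x → x) (Eq-reflʳ A q))))
  , proj₁ (proj₂ (eval-Eq t e)) , eval-lam-uniform (app (weaken t) (var ze)) e'
  where e' = EqEnv-reflʳ e
eval-≈ (≈refl {t = t}) e = eval-Eq t e
eval-≈ (≈sym p)        e = Eq-sym _ (eval-≈ p (EqEnv-sym e))
eval-≈ (≈trans p q)    e = Eq-trans _ (eval-≈ p e) (eval-≈ q (EqEnv-reflʳ e))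
eval-≈ (≈lam {t = t} {u = u} p) e =
  (λ r q → eval-≈ p (extE-Eq (renE-Eq r e) q))
  , eval-lam-uniform t (EqEnv-reflˡ e) , eval-lam-uniform u (EqEnv-reflʳ e)
eval-≈ (≈app p q)      e = proj₁ (eval-≈ p e) (λ v → v) (eval-≈ q e)

nf-complete : {t u : Tm Γ A} → t ≈ u → nf t ≡ nf u
nf-complete p = reify-Eq _ (eval-≈ p idE-Eq)

Rel : ∀ A → Tm Γ A → Val Γ A → Set
Rel ι       t n = t ≈ embNe n
Rel (A ⇒ B) t f = ∀ {Δ} (r : Ren _ Δ) {s v} → Rel A s v → Rel B (app (rename r t) s) (f r v)

Rel-≈ : ∀ A {t t' : Tm Γ A} {v} → t ≈ t' → Rel A t v → Rel A t' v
Rel-≈ ι       p h = ≈trans (≈sym p) h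
Rel-≈ (A ⇒ B) p h = λ r q → Rel-≈ B (≈app (rename-≈ r p) ≈refl) (h r q)

Rel-rename : ∀ A (r : Ren Γ Δ) {t v} → Rel A t v → Rel A (rename r t) (renV A r v)
Rel-rename ι       r {v = n} h = ≈trans (rename-≈ r h) (≡⇒≈ (rename-embNe r n))
Rel-rename (A ⇒ B) r {t}     h =
  λ r' q → Rel-≈ B (≈app (≡⇒≈ (sym (rename-∘ r' r t))) ≈refl) (h (λ x → r' (r x)) q)

mutual
  reflect-Rel : ∀ A {t : Tm Γ A} {n} → t ≈ embNe n → Rel A t (reflect A n)
  reflect-Rel ι       p         = p
  reflect-Rel (A ⇒ B) {n = n} p =
    λ r q → reflect-Rel B (≈app (≈trans (rename-≈ r p) (≡⇒≈ (rename-embNe r n))) (reify-Rel A q))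

  reify-Rel : ∀ A {t : Tm Γ A} {v} → Rel A t v → t ≈ embNf (reify A v)
  reify-Rel ι       p     = p
  reify-Rel (A ⇒ B) {t} h = ≈trans (η t) (≈lam (reify-Rel B (h su (reflect-Rel A ≈refl))))

subst-Rel : (t : Tm Γ A) (s : Subst Γ Δ) (ρ : Env Γ Δ) → (∀ {C} (x : Var Γ C) → Rel C (s x) (ρ x)) →
            Rel A (subst s t) (eval t ρ)
subst-Rel (var x) s ρ h = h x
subst-Rel {A = B} (app t u) s ρ h =
  Rel-≈ B (≈app (≡⇒≈ (rename-id _)) ≈refl) (subst-Rel t s ρ h (λ x → x) (subst-Rel u s ρ h))
subst-Rel {A = A ⇒ B} (lam t) s ρ h r {s'} {v} q =
  Rel-≈ B (≈sym (≈trans (β _ _) (≡⇒≈ instantiate))) (subst-Rel t s'∷rs (extE (renE r ρ) v) related)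
  where
  s'∷rs : Subst (A ∷ _) _
  s'∷rs ze     = s'
  s'∷rs (su x) = rename r (s x)

  related : ∀ {C} (x : Var _ C) → Rel C (s'∷rs x) (extE (renE r ρ) v x)
  related ze     = q
  related (su x) = Rel-rename _ r (h x)

  pointwise : ∀ {C} (x : Var _ C) → subst (single s') (rename (liftR r) (liftS s x)) ≡ s'∷rs x
  pointwise ze     = refl
  pointwise (su x) = trans (cong (subst (single s')) (rename-liftR-weaken r (s x)))
                           (subst-single-weaken s' (rename r (s x)))

  instantiate : subst (single s') (rename (liftR r) (subst (liftS s) t)) ≡ subst s'∷rs t
  instantiate = begin
    subst (single s') (rename (liftR r) (subst (liftS s) t))
      ≡⟨ cong (subst (single s')) (rename-subst (liftR r) (liftS s) t) ⟩
    subst (single s') (subst _ t)                              ≡⟨ subst-∘ (single s') _ t ⟩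
    subst _ t                                                  ≡⟨ subst-cong pointwise t ⟩
    subst s'∷rs t                                              ∎
    where open ≡-Reasoning

nf-sound : (t : Tm Γ A) → t ≈ embNf (nf t)
nf-sound {A = A} t =
  reify-Rel A (Rel-≈ A (≡⇒≈ (subst-var t)) (subst-Rel t var idE (λ x → reflect-Rel _ ≈refl)))

mutual
  reify-eval-embNf : (p : Nf Γ A) {ρ : Env Γ Γ} → EqEnv ρ idE → reify A (eval (embNf p) ρ) ≡ p
  reify-eval-embNf (neN n)                 e = cong neN (eval-embNe n e)
  reify-eval-embNf {A = A ⇒ B} (lamN p) {ρ} e = cong lamN (reify-eval-embNf p e')
    where
    e' : EqEnv (extE (renE su ρ) (reflect A (varN ze))) idE
    e' ze     = reflect-Eq A (varN ze)
    e' (su x) = Eq-trans _ (renV-Eq _ su (e x)) (renV-reflect _ su (varN x))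

  eval-embNe : (n : Ne Γ A) {ρ : Env Γ Γ} → EqEnv ρ idE → Eq A (eval (embNe n) ρ) (reflect A n)
  eval-embNe (varN x)                   e = e x
  eval-embNe {A = B} (appN {A = A} n p) {ρ} e =
    Eq-trans B (proj₁ (eval-embNe n e) (λ x → x) (eval-Eq (embNf p) (EqEnv-reflˡ e))) same-neutral
    where
    same-neutral : Eq B (reflect B (appN (renNe (λ x → x) n) (reify A (eval (embNf p) ρ)))) (reflect B (appN n p))
    same-neutral rewrite renNe-id n | reify-eval-embNf p e = reflect-Eq B _

nf-embNf : (p : Nf Γ A) → nf (embNf p) ≡ p
nf-embNf p = reify-eval-embNf p idE-Eq

embNf-injective : {p q : Nf Γ A} → embNf p ≈ embNf q → p ≡ q
embNf-injective {p = p} {q} h = trans (sym (nf-embNf p)) (trans (nf-complete h) (nf-embNf q))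

≈-by-nf : {t u : Tm Γ A} → nf t ≡ nf u → t ≈ u
≈-by-nf {t = t} {u} e = ≈trans (nf-sound t) (≈trans (≡⇒≈ (cong embNf e)) (≈sym (nf-sound u)))

_≡ᵛ_ : Var Γ A → Var Γ B → Set
_≡ᵛ_ {Γ} {A} {B} a b = _≡_ {A = Σ Ty (Var Γ)} (A , a) (B , b)

spineNe : ∀ A → Ne Γ A → All (Nf Γ) (args A) → Ne Γ ι
spineNe ι       n []       = n
spineNe (A ⇒ B) n (p ∷ ps) = spineNe B (appN n p) ps

embNe-spineNe : ∀ A (n : Ne Γ A) ps → embNe (spineNe A n ps) ≡ apps A (embNe n) (All.map embNf ps)
embNe-spineNe ι       n []       = refl
embNe-spineNe (A ⇒ B) n (p ∷ ps) = embNe-spineNe B (appN n p) ps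

spineNe-injective : ∀ A {n n' : Ne Γ A} {ps qs} → spineNe A n ps ≡ spineNe A n' qs → n ≡ n' × ps ≡ qs
spineNe-injective ι       {ps = []}     {[]}     e = e , refl
spineNe-injective (A ⇒ B) {ps = p ∷ ps} {q ∷ qs} e with spineNe-injective B e
... | refl , refl = refl , refl

head : Ne Γ C → Σ Ty (Var Γ)
head (varN {A = A} v) = A , v
head (appN n p)       = head n

head-spineNe : ∀ A (n : Ne Γ A) ps → head (spineNe A n ps) ≡ head n
head-spineNe ι       n []       = refl
head-spineNe (A ⇒ B) n (p ∷ ps) = head-spineNe B (appN n p) ps

PwEq-refl : ∀ {As} (ms : All (Tm Γ) As) → PwEq As ms ms
PwEq-refl []       = []
PwEq-refl (m ∷ ms) = ≈refl ∷ PwEq-refl ms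

PwEq-head : ∀ {As} {m n : Tm Γ A} {ms ns : All (Tm Γ) As} → PwEq (A ∷ As) (m ∷ ms) (n ∷ ns) → m ≈ n
PwEq-head (p ∷ _) = p

apps-≈ : ∀ A {t t' : Tm Γ A} {ms ms'} → t ≈ t' → PwEq (args A) ms ms' → apps A t ms ≈ apps A t' ms'
apps-≈ ι       p []       = p
apps-≈ (A ⇒ B) p (q ∷ qs) = apps-≈ B (≈app p q) qs

PwEq-by-nf : ∀ {As} (ms ns : All (Tm Γ) As) → All.map nf ms ≡ All.map nf ns → PwEq As ms ns
PwEq-by-nf []       []       refl = []
PwEq-by-nf (m ∷ ms) (n ∷ ns) e =
  ≈-by-nf (proj₁ (All-∷-injective e)) ∷ PwEq-by-nf ms ns (proj₂ (All-∷-injective e))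
  where
  All-∷-injective : ∀ {P : Ty → Set} {As} {x y : P A} {xs ys : All P As} →
                    _≡_ {A = All P (A ∷ As)} (x ∷ xs) (y ∷ ys) → x ≡ y × xs ≡ ys
  All-∷-injective refl = refl , refl

apps-var≈spineNe : ∀ A (a : Var Γ A) ms → apps A (var a) ms ≈ embNe (spineNe A (varN a) (All.map nf ms))
apps-var≈spineNe A a ms =
  ≈trans (apps-≈ A ≈refl (sound ms)) (≡⇒≈ (sym (embNe-spineNe A (varN a) (All.map nf ms))))
  where
  sound : ∀ {As} (ms : All (Tm _) As) → PwEq As ms (All.map embNf (All.map nf ms))
  sound []       = []
  sound (m ∷ ms) = nf-sound m ∷ sound ms

apps-var-≈⇒spineNe-≡ : {a : Var Γ A} {b : Var Γ B} {ms : Args Γ A} {ns : Args Γ B} →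
                     apps A (var a) ms ≈ apps B (var b) ns →
                     spineNe A (varN a) (All.map nf ms) ≡ spineNe B (varN b) (All.map nf ns)
apps-var-≈⇒spineNe-≡ {A = A} {B} {a} {b} {ms} {ns} h = neN-injective (embNf-injective
  (≈trans (≈sym (apps-var≈spineNe A a ms)) (≈trans h (apps-var≈spineNe B b ns))))
  where
  neN-injective : {n m : Ne Γ ι} → neN n ≡ neN m → n ≡ m
  neN-injective refl = refl

apps-head-injective : {a : Var Γ A} {b : Var Γ B} {ms : Args Γ A} {ns : Args Γ B} →
                      apps A (var a) ms ≈ apps B (var b) ns → a ≡ᵛ b
apps-head-injective {A = A} {B} {a} {b} {ms} {ns} h = begin
  (A , a)                                      ≡⟨ head-spineNe A (varN a) (All.map nf ms) ⟨
  head (spineNe A (varN a) (All.map nf ms))    ≡⟨ cong head (apps-var-≈⇒spineNe-≡ {a = a} {b} {ms} {ns} h) ⟩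
  head (spineNe B (varN b) (All.map nf ns))    ≡⟨ head-spineNe B (varN b) (All.map nf ns) ⟩
  (B , b)                                      ∎
  where open ≡-Reasoning

apps-args-injective : {a : Var Γ A} {ms ns : Args Γ A} →
                      apps A (var a) ms ≈ apps A (var a) ns → PwEq (args A) ms ns
apps-args-injective {A = A} {a = a} {ms} {ns} h =
  PwEq-by-nf ms ns (proj₂ (spineNe-injective A (apps-var-≈⇒spineNe-≡ {a = a} {a} {ms} {ns} h)))

compose : ∀ A → Tm Γ one → Tm Γ A → Tm Γ A
compose ι       g t = app g t
compose (A ⇒ B) g t = lam (compose B (weaken g) (app (weaken t) (var ze)))

subst-compose : ∀ A (s : Subst Γ Δ) g t → subst s (compose A g t) ≡ compose A (subst s g) (subst s t)
subst-compose ι       s g t = refl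
subst-compose (A ⇒ B) s g t = cong lam (trans (subst-compose B (liftS s) _ _)
  (cong₂ (compose B) (subst-liftS-weaken s g) (cong (λ x → app x (var ze)) (subst-liftS-weaken s t))))

rename-compose : ∀ A (r : Ren Γ Δ) g t → rename r (compose A g t) ≡ compose A (rename r g) (rename r t)
rename-compose A r g t = begin
  rename r (compose A g t)                                           ≡⟨ subst-var≡rename r _ ⟨
  subst (λ v → var (r v)) (compose A g t)                           ≡⟨ subst-compose A _ g t ⟩
  compose A (subst (λ v → var (r v)) g) (subst (λ v → var (r v)) t)
    ≡⟨ cong₂ (compose A) (subst-var≡rename r g) (subst-var≡rename r t) ⟩
  compose A (rename r g) (rename r t)                                ∎
  where open ≡-Reasoning

app-compose : ∀ A B (g : Tm Γ one) t s → app (compose (A ⇒ B) g t) s ≈ compose B g (app t s)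
app-compose A B g t s = ≈trans (β _ _) (≡⇒≈ (trans (subst-compose B (single s) _ _)
  (cong₂ (compose B) (subst-single-weaken s g) (cong (λ x → app x s) (subst-single-weaken s t)))))

module HoleFilling {Θ : Ctx} {A : Ty} (z : Var Θ A) where

  g∘z : Tm (one ∷ Θ) A
  g∘z = compose A (var ze) (var (su z))

  -- The hole is the variable at position |Ψ|; it is replaced by g ∘ z, where g is a
  -- fresh variable of type one put at the same position.
  σ : ∀ Ψ → Subst (Ψ ++ A ∷ Θ) (Ψ ++ one ∷ Θ)
  σ []      ze     = g∘z
  σ []      (su v) = var (su v)
  σ (B ∷ Ψ) v      = liftS (σ Ψ) v

  gᵛ : ∀ Ψ → Var (Ψ ++ one ∷ Θ) one
  gᵛ []      = ze
  gᵛ (B ∷ Ψ) = su (gᵛ Ψ)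

  zᵛ : ∀ Ψ → Var (Ψ ++ one ∷ Θ) A
  zᵛ []      = su z
  zᵛ (B ∷ Ψ) = su (zᵛ Ψ)

  -- A pair (true , t) stands for g ∘ t and (false , t) for t itself.
  ⌜_⌝ : ∀ {Ψ} → Bool × Ne (Ψ ++ one ∷ Θ) C → Tm (Ψ ++ one ∷ Θ) C
  ⌜_⌝ {Ψ = Ψ} (true  , n) = compose _ (var (gᵛ Ψ)) (embNe n)
  ⌜_⌝         (false , n) = embNe n

  σ-var : ∀ Ψ → Var (Ψ ++ A ∷ Θ) C → Bool × Var (Ψ ++ one ∷ Θ) C
  σ-var []      ze     = true , zᵛ []
  σ-var []      (su v) = false , su v
  σ-var (B ∷ Ψ) ze     = false , ze
  σ-var (B ∷ Ψ) (su v) = proj₁ (σ-var Ψ v) , su (proj₂ (σ-var Ψ v))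

  close : ∀ Ψ → Bool × Ne (Ψ ++ one ∷ Θ) ι → Nf (Ψ ++ one ∷ Θ) ι
  close Ψ (true  , n) = neN (appN (varN (gᵛ Ψ)) (neN n))
  close Ψ (false , n) = neN n

  mutual
    σ-ne : ∀ Ψ → Ne (Ψ ++ A ∷ Θ) C → Bool × Ne (Ψ ++ one ∷ Θ) C
    σ-ne Ψ (varN v)   = proj₁ (σ-var Ψ v) , varN (proj₂ (σ-var Ψ v))
    σ-ne Ψ (appN n p) = proj₁ (σ-ne Ψ n) , appN (proj₂ (σ-ne Ψ n)) (σ-nf Ψ p)

    σ-nf : ∀ Ψ → Nf (Ψ ++ A ∷ Θ) C → Nf (Ψ ++ one ∷ Θ) C
    σ-nf Ψ (neN n)  = close Ψ (σ-ne Ψ n)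
    σ-nf Ψ (lamN p) = lamN (σ-nf (_ ∷ Ψ) p)

  σ≡⌜σ-ne-varN⌝ : ∀ Ψ (v : Var (Ψ ++ A ∷ Θ) C) → σ Ψ v ≡ ⌜ σ-ne Ψ (varN v) ⌝
  σ≡⌜σ-ne-varN⌝ []      ze     = refl
  σ≡⌜σ-ne-varN⌝ []      (su v) = refl
  σ≡⌜σ-ne-varN⌝ (B ∷ Ψ) ze     = refl
  σ≡⌜σ-ne-varN⌝ (B ∷ Ψ) (su v) with σ-var Ψ v | σ≡⌜σ-ne-varN⌝ Ψ v
  ... | false , x | e = cong weaken e
  ... | true  , x | e = trans (cong weaken e) (rename-compose _ su _ _)

  mutual
    subst-σ-embNe : ∀ Ψ (n : Ne (Ψ ++ A ∷ Θ) C) → subst (σ Ψ) (embNe n) ≈ ⌜ σ-ne Ψ n ⌝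
    subst-σ-embNe Ψ (varN v) = ≡⇒≈ (σ≡⌜σ-ne-varN⌝ Ψ v)
    subst-σ-embNe Ψ (appN n p) with σ-ne Ψ n | subst-σ-embNe Ψ n
    ... | false , m | e = ≈app e (subst-σ-embNf Ψ p)
    ... | true  , m | e = ≈trans (≈app e (subst-σ-embNf Ψ p)) (app-compose _ _ _ _ _)

    subst-σ-embNf : ∀ Ψ (p : Nf (Ψ ++ A ∷ Θ) C) → subst (σ Ψ) (embNf p) ≈ embNf (σ-nf Ψ p)
    subst-σ-embNf Ψ (lamN p) = ≈lam (subst-σ-embNf (_ ∷ Ψ) p)
    subst-σ-embNf Ψ (neN n) with σ-ne Ψ n | subst-σ-embNe Ψ n
    ... | false , m | e = e
    ... | true  , m | e = e

  σ-var-injective : ∀ Ψ (v u : Var (Ψ ++ A ∷ Θ) C) → σ-var Ψ v ≡ σ-var Ψ u → v ≡ u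
  σ-var-injective []      ze     ze     e    = refl
  σ-var-injective []      ze     (su u) ()
  σ-var-injective []      (su v) ze     ()
  σ-var-injective []      (su v) (su u) refl = refl
  σ-var-injective (B ∷ Ψ) ze     ze     e    = refl
  σ-var-injective (B ∷ Ψ) ze     (su u) e    with () ← cong proj₂ e
  σ-var-injective (B ∷ Ψ) (su v) ze     e    with () ← cong proj₂ e
  σ-var-injective (B ∷ Ψ) (su v) (su u) e    = cong su (σ-var-injective Ψ v u (unsu e))
    where
    unsu : {p q : Bool × Var (Ψ ++ one ∷ Θ) C} →
           _≡_ {A = Bool × Var (B ∷ Ψ ++ one ∷ Θ) C}
               (proj₁ p , su (proj₂ p)) (proj₁ q , su (proj₂ q)) → p ≡ q
    unsu refl = refl

  σ-var≢g : ∀ Ψ (v : Var (Ψ ++ A ∷ Θ) one) → σ-var Ψ v ≡ (false , gᵛ Ψ) → ⊥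
  σ-var≢g []      ze     ()
  σ-var≢g []      (su v) ()
  σ-var≢g (B ∷ Ψ) ze     ()
  σ-var≢g (B ∷ Ψ) (su v) e = σ-var≢g Ψ v (unsu e)
    where
    unsu : {p : Bool × Var (Ψ ++ one ∷ Θ) one} →
           _≡_ {A = Bool × Var (B ∷ Ψ ++ one ∷ Θ) one} (proj₁ p , su (proj₂ p)) (false , su (gᵛ Ψ)) →
           p ≡ (false , gᵛ Ψ)
    unsu refl = refl

  -- Since close turns a tagged n into g n, this keeps it from confusing the two tags.
  σ-ne-untagged-head : ∀ Ψ (n : Ne (Ψ ++ A ∷ Θ) C) → proj₁ (σ-ne Ψ n) ≡ false →
                      head (proj₂ (σ-ne Ψ n)) ≡ (one , gᵛ Ψ) → ⊥
  σ-ne-untagged-head Ψ (varN v)   untagged g-head with σ-var Ψ v in e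
  σ-ne-untagged-head Ψ (varN v)   refl     refl   | false , _ = σ-var≢g Ψ v e
  σ-ne-untagged-head Ψ (appN n p) untagged g-head = σ-ne-untagged-head Ψ n untagged g-head

  close-injective : ∀ Ψ (n m : Ne (Ψ ++ A ∷ Θ) ι) →
                    close Ψ (σ-ne Ψ n) ≡ close Ψ (σ-ne Ψ m) → σ-ne Ψ n ≡ σ-ne Ψ m
  close-injective Ψ n m e with σ-ne Ψ n in en | σ-ne Ψ m in em
  ... | true  , n' | true  , m' with refl ← e = refl
  ... | false , n' | false , m' with refl ← e = refl
  ... | true  , n' | false , m' with refl ← e =
    ⊥-elim (σ-ne-untagged-head Ψ m (cong proj₁ em) (cong (head ∘ proj₂) em))
  ... | false , n' | true  , m' with refl ← e =
    ⊥-elim (σ-ne-untagged-head Ψ n (cong proj₁ en) (cong (head ∘ proj₂) en))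

  mutual
    σ-ne-injective : ∀ Ψ (n m : Ne (Ψ ++ A ∷ Θ) C) → σ-ne Ψ n ≡ σ-ne Ψ m → n ≡ m
    σ-ne-injective Ψ (varN v)   (varN u)   e = cong varN (σ-var-injective Ψ v u (unvarN e))
      where
      unvarN : ∀ {p q : Bool × Var (Ψ ++ one ∷ Θ) C} →
               _≡_ {A = Bool × Ne (Ψ ++ one ∷ Θ) C}
                   (proj₁ p , varN (proj₂ p)) (proj₁ q , varN (proj₂ q)) → p ≡ q
      unvarN refl = refl
    σ-ne-injective Ψ (varN v)   (appN m q) e with () ← cong proj₂ e
    σ-ne-injective Ψ (appN n p) (varN u)   e with () ← cong proj₂ e
    σ-ne-injective Ψ (appN n p) (appN m q) e
      with σ-ne Ψ n in en | σ-ne Ψ m in em | σ-nf Ψ p in ep | σ-nf Ψ q in eq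
    ... | _ | _ | _ | _ with refl ← e =
      cong₂ appN (σ-ne-injective Ψ n m (trans en (sym em))) (σ-nf-injective Ψ p q (trans ep (sym eq)))

    σ-nf-injective : ∀ Ψ (p q : Nf (Ψ ++ A ∷ Θ) C) → σ-nf Ψ p ≡ σ-nf Ψ q → p ≡ q
    σ-nf-injective Ψ (neN n)  (neN m)  e = cong neN (σ-ne-injective Ψ n m (close-injective Ψ n m e))
    σ-nf-injective Ψ (lamN p) (lamN q) e = cong lamN (σ-nf-injective (_ ∷ Ψ) p q (unlamN e))
      where
      unlamN : ∀ {Γ B C} {p q : Nf (B ∷ Γ) C} → lamN p ≡ lamN q → p ≡ q
      unlamN refl = refl

  subst-σ-injective : ∀ Ψ (t u : Tm (Ψ ++ A ∷ Θ) C) → subst (σ Ψ) t ≈ subst (σ Ψ) u → t ≈ u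
  subst-σ-injective Ψ t u h = ≈-by-nf (σ-nf-injective Ψ _ _ (embNf-injective (begin
    embNf (σ-nf Ψ (nf t))      ≈⟨ subst-σ-embNf Ψ (nf t) ⟨
    subst (σ Ψ) (embNf (nf t)) ≈⟨ subst-≈ (σ Ψ) (nf-sound t) ⟨
    subst (σ Ψ) t              ≈⟨ h ⟩
    subst (σ Ψ) u              ≈⟨ subst-≈ (σ Ψ) (nf-sound u) ⟩
    subst (σ Ψ) (embNf (nf u)) ≈⟨ subst-σ-embNf Ψ (nf u) ⟩
    embNf (σ-nf Ψ (nf u))      ∎)))
    where open ≈-Reasoning

  app-g∘z-injective : (M N : Tm Θ (A ⇒ C)) → app (weaken M) g∘z ≈ app (weaken N) g∘z → M ≈ N
  app-g∘z-injective M N h = begin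
    M                            ≈⟨ η M ⟩
    lam (app (weaken M) (var ze)) ≈⟨ ≈lam (subst-σ-injective [] _ _ (begin
      subst (σ []) (app (weaken M) (var ze)) ≡⟨ cong (λ t → app t g∘z) (subst-σ-weaken M) ⟩
      app (weaken M) g∘z                     ≈⟨ h ⟩
      app (weaken N) g∘z                     ≡⟨ cong (λ t → app t g∘z) (subst-σ-weaken N) ⟨
      subst (σ []) (app (weaken N) (var ze)) ∎)) ⟩
    lam (app (weaken N) (var ze)) ≈⟨ η N ⟨
    N                            ∎
    where
    open ≈-Reasoning
    subst-σ-weaken : (M : Tm Θ B) → subst (σ []) (weaken M) ≡ weaken M
    subst-σ-weaken M = trans (subst-rename (σ []) su M) (subst-var≡rename su M)

injL : ∀ Ξ → Var Ξ C → Var (Ξ ++ Ψ) C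
injL (X ∷ Ξ) ze     = ze
injL (X ∷ Ξ) (su u) = su (injL Ξ u)

injR : ∀ Ξ → Var Ψ C → Var (Ξ ++ Ψ) C
injR []      u = u
injR (X ∷ Ξ) u = su (injR Ξ u)

data Split (Ξ Ψ : Ctx) : Var (Ξ ++ Ψ) C → Set where
  inl : (u : Var Ξ C) → Split Ξ Ψ (injL Ξ u)
  inr : (u : Var Ψ C) → Split Ξ Ψ (injR Ξ u)

split : ∀ Ξ (v : Var (Ξ ++ Ψ) C) → Split Ξ Ψ v
split []      v      = inr v
split (X ∷ Ξ) ze     = inl ze
split (X ∷ Ξ) (su v) with split Ξ v
... | inl u = inl (su u)
... | inr u = inr u

su-injectiveᵛ : ∀ {X} {a : Var Γ C} {b : Var Γ D} → su {B = X} a ≡ᵛ su b → a ≡ᵛ b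
su-injectiveᵛ refl = refl

injL-injective : ∀ Ξ (u : Var Ξ C) (u' : Var Ξ D) → injL {Ψ = Ψ} Ξ u ≡ᵛ injL Ξ u' → u ≡ᵛ u'
injL-injective (X ∷ Ξ) ze     ze      e  = refl
injL-injective (X ∷ Ξ) ze     (su u') ()
injL-injective (X ∷ Ξ) (su u) ze      ()
injL-injective (X ∷ Ξ) (su u) (su u') e  with refl ← injL-injective Ξ u u' (su-injectiveᵛ e) = refl

injL≢injR : ∀ Ξ (u : Var Ξ C) (w : Var Ψ D) → injL Ξ u ≡ᵛ injR Ξ w → ⊥
injL≢injR (X ∷ Ξ) ze     w ()
injL≢injR (X ∷ Ξ) (su u) w e = injL≢injR Ξ u w (su-injectiveᵛ e)

extΞ-injL : ∀ Ξ (ρ : Subst Γ Δ) (u : Var Ξ C) → extΞ Ξ ρ (injL Ξ u) ≡ var (injL Ξ u)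
extΞ-injL (X ∷ Ξ) ρ ze     = refl
extΞ-injL (X ∷ Ξ) ρ (su u) = cong weaken (extΞ-injL Ξ ρ u)

extΞ-injR : ∀ Ξ (ρ : Subst Γ Δ) (u : Var Γ C) → extΞ Ξ ρ (injR Ξ u) ≡ rename (injR Ξ) (ρ u)
extΞ-injR []      ρ u = sym (rename-id (ρ u))
extΞ-injR (X ∷ Ξ) ρ u = trans (cong weaken (extΞ-injR Ξ ρ u)) (rename-∘ su (injR Ξ) (ρ u))

module _ (A : Ty) where

  Γ₀ Δ₀ : Ctx
  Γ₀ = ((A ⇒ ι) ⇒ ι) ∷ []
  Δ₀ = three ∷ A ∷ []

  -- ϱ x = λN. f (λg. N (g ∘ z)), where Δ₀ = f, z.
  ϱ : Subst Γ₀ Δ₀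
  ϱ ze = lam (app (var (su ze)) (lam (app (var (su ze)) (HoleFilling.g∘z (su (su ze))))))

  module _ (Ξ : Ctx) where
    open HoleFilling {Θ = Ξ ++ Δ₀} (injR Ξ (su ze)) using (g∘z; app-g∘z-injective)

    ϱx[_] : Tm (Ξ ++ Δ₀) (A ⇒ ι) → Tm (Ξ ++ Δ₀) ι
    ϱx[ N ] = app (var (injR Ξ ze)) (lam (app (weaken N) g∘z))

    ϱ-β : (N : Tm (Ξ ++ Δ₀) (A ⇒ ι)) → app (extΞ Ξ ϱ (injR Ξ ze)) N ≈ ϱx[ N ]
    ϱ-β N = ≈trans (≈app (≡⇒≈ (extΞ-injR Ξ ϱ ze)) ≈refl) (≈trans (β _ N)
      (≡⇒≈ (cong (λ k → app (var (injR Ξ ze)) (lam (app (weaken N) k)))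
                 (trans (subst-rename _ _ (HoleFilling.g∘z (su (su ze)))) (subst-compose A _ _ _)))))

    ϱx-injective : (M N : Tm (Ξ ++ Δ₀) (A ⇒ ι)) → ϱx[ M ] ≈ ϱx[ N ] → M ≈ N
    ϱx-injective M N h = app-g∘z-injective M N (lam-injective (PwEq-head
      (apps-args-injective {A = three} {ms = _ ∷ []} {ns = _ ∷ []} h)))

    injL≉ϱx : (u : Var Ξ C) (ms : Args (Ξ ++ Δ₀) C) (N : Tm (Ξ ++ Δ₀) (A ⇒ ι)) →
              apps C (var (injL Ξ u)) ms ≈ ϱx[ N ] → ⊥
    injL≉ϱx u ms N h = injL≢injR Ξ u ze (apps-head-injective {B = three} {ms = ms} {ns = _ ∷ []} h)

    ϱ-injL : (u : Var Ξ C) (ms : Args (Ξ ++ Δ₀) C) →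
             apps C (extΞ Ξ ϱ (injL Ξ u)) ms ≈ apps C (var (injL Ξ u)) ms
    ϱ-injL {C} u ms = apps-≈ C (≡⇒≈ (extΞ-injL Ξ ϱ u)) (PwEq-refl ms)

    ϱ-atomic-split : (a : Var (Ξ ++ Γ₀) C) (b : Var (Ξ ++ Γ₀) D) → Split Ξ Γ₀ a → Split Ξ Γ₀ b →
                     (ms : Args (Ξ ++ Δ₀) C) (ns : Args (Ξ ++ Δ₀) D) →
                     apps C (extΞ Ξ ϱ a) ms ≈ apps D (extΞ Ξ ϱ b) ns → SameApp a ms b ns
    ϱ-atomic-split _ _ (inl u) (inl u') ms ns h
      with h' ← ≈trans (≈sym (ϱ-injL u ms)) (≈trans h (ϱ-injL u' ns))
      with refl ← injL-injective Ξ u u' (apps-head-injective h') = same (apps-args-injective h')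
    ϱ-atomic-split _ _ (inl u) (inr ze) ms (N ∷ []) h =
      ⊥-elim (injL≉ϱx u ms N (≈trans (≈sym (ϱ-injL u ms)) (≈trans h (ϱ-β N))))
    ϱ-atomic-split _ _ (inr ze) (inl u) (M ∷ []) ns h =
      ⊥-elim (injL≉ϱx u ns M (≈trans (≈sym (ϱ-injL u ns)) (≈trans (≈sym h) (ϱ-β M))))
    ϱ-atomic-split _ _ (inr ze) (inr ze) (M ∷ []) (N ∷ []) h =
      same (ϱx-injective M N (≈trans (≈sym (ϱ-β M)) (≈trans h (ϱ-β N))) ∷ [])

  ϱ-atomic : AtomicReduction ϱ
  ϱ-atomic Ξ a b = ϱ-atomic-split Ξ a b (split Ξ a) (split Ξ b)

lemmaL : ∀ (A : Ty) → ⟦ ⟦ ⟦ A ∷ [] ⟧ ∷ [] ⟧ ∷ [] ⟧ ≤ᵃ ⟦ three ∷ A ∷ [] ⟧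
lemmaL A = ϱ A , ϱ-atomic A
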